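{- Let $P$ and $P'$ be two instances of problem FM with the same $m$ machines and $k$ ranks, such that $P'$ is obtained from $P$ by increasing the processing times of one or more jobs of rank $1$ and leaving all other processing times unchanged. Then the largest makespan of an $LD_0$ schedule for $P'$ is at least the largest makespan of an $LD_0$ schedule for $P$.
   Context: Problem FM: there are $m\ge 1$ identical parallel machines and $n=mk$ jobs ($k\ge 1$ is the number of ranks; an instance with fewer jobs is padded with jobs of processing time $0$), with nonnegative real processing times indexed so that $p_1\ge p_2\ge\cdots\ge p_n$. For $r\in\{1,\dots,k\}$, rank $r$ is the set of jobs $(r-1)m+1,\dots,rm$. A flowtime-optimal schedule assigns to every machine exactly one job from each rank and processes the jobs on each machine consecutively from time $0$ without idle time, in the order rank $k$, rank $k-1$, \dots, rank $1$; its makespan is the largest machine completion time. An $LD_0$ schedule is a flowtime-optimal schedule constructed as follows: the jobs of rank $1$ are assigned to the machines arbitrarily (one per machine); the jobs of rank $2$ are assigned largest-first, i.e. in nonincreasing order of processing time each to the earliest available machine (so the largest rank-2 job goes on the machine with the smallest rank-1 job, etc.); the jobs of each remaining rank are assigned arbitrarily (one per machine); finally the job order on each machine is reversed. An $LD_{0_{worst}}$ schedule is an $LD_0$ schedule of largest makespan for the instance.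
   Formalization: The processing times of both instances are rational rather than real. -}

module Defs where

open import Data.Nat using (ℕ; zero; suc)
open import Data.Fin using (Fin; zero; suc; toℕ; _<_; _≤_)
open import Data.Rational using (ℚ; 0ℚ; _+_; _⊔_) renaming (_≤_ to _≤ℚ_)
open import Data.Product using (Σ; _×_)
open import Relation.Binary.PropositionalEquality using (_≡_; _≢_)
open import Function.Definitions using (Injective)

-- An instance of problem FM with m = suc m' machines and k = suc k' ranks.
-- Processing times are given as  p r i  = processing time of the (i+1)-th job of
-- rank (r+1), i.e. of job number r*m + i + 1 in the paper's flat indexing.
Times : ℕ → ℕ → Set
Times k' m' = Fin (suc k') → Fin (suc m') → ℚ

-- FM instance: nonnegative times, sorted p_1 ≥ p_2 ≥ ... ≥ p_n in the flat
-- (lexicographic rank-major) indexing.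
record FMInstance {k' m' : ℕ} (p : Times k' m') : Set where
  field
    nonneg       : ∀ r i → 0ℚ ≤ℚ p r i
    sorted-in    : ∀ r (i j : Fin (suc m')) → i ≤ j → p r j ≤ℚ p r i
    sorted-ranks : ∀ (r s : Fin (suc k')) (i j : Fin (suc m')) → r < s → p s j ≤ℚ p r i

-- A flowtime-optimal schedule: for each rank r, machine i receives the job
-- σ r i of rank r; each σ r must be a bijection (injective on Fin m).
Schedule : ℕ → ℕ → Set
Schedule k' m' = Fin (suc k') → Fin (suc m') → Fin (suc m')

sumF : (n : ℕ) → (Fin n → ℚ) → ℚ
sumF zero    f = 0ℚ
sumF (suc n) f = f zero + sumF n (λ i → f (suc i))

maxF : (n : ℕ) → (Fin (suc n) → ℚ) → ℚ
maxF zero    f = f zero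
maxF (suc n) f = f zero ⊔ maxF n (λ i → f (suc i))

-- completion time of machine i (independent of the job order on the machine,
-- since there is no idle time)
load : {k' m' : ℕ} → Times k' m' → Schedule k' m' → Fin (suc m') → ℚ
load {k'} p σ i = sumF (suc k') (λ r → p r (σ r i))

makespan : {k' m' : ℕ} → Times k' m' → Schedule k' m' → ℚ
makespan {k'} {m'} p σ = maxF m' (load p σ)

-- Largest-first assignment of rank-2 jobs (times b, assignment t) to machines
-- currently holding only their rank-1 job (times a, assignment s):
-- π u is the machine chosen at step u (π injective); the jobs are taken in
-- nonincreasing order of processing time, and at each step the chosen machine
-- has the smallest current load (= its rank-1 job time) among the machines not
-- chosen at an earlier step.
LargestFirst : {m' : ℕ} → (a b : Fin (suc m') → ℚ) → (s t : Fin (suc m') → Fin (suc m')) → Set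
LargestFirst {m'} a b s t =
  Σ (Fin (suc m') → Fin (suc m')) λ π →
    Injective _≡_ _≡_ π
    × (∀ (u v : Fin (suc m')) → u ≤ v → b (t (π v)) ≤ℚ b (t (π u)))
    × (∀ (u : Fin (suc m')) (i : Fin (suc m')) →
         (∀ (v : Fin (suc m')) → v < u → π v ≢ i) → a (s (π u)) ≤ℚ a (s i))

-- LD_0 schedule (the final order reversal does not affect machine loads).
record LD0 {k' m' : ℕ} (p : Times k' m') (σ : Schedule k' m') : Set where
  field
    bijective : ∀ r → Injective _≡_ _≡_ (σ r)
    rank2     : ∀ (r2 : Fin (suc k')) → toℕ r2 ≡ 1 →
                LargestFirst (p zero) (p r2) (σ zero) (σ r2)

{-# OPTIONS --safe #-}
module Submission where

-- Let i be a machine of maximal load in an LD₀ schedule σ for P. In every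
-- instance, giving machine j the (j+1)-th largest rank-2 job together with the
-- (j+1)-th smallest rank-1 job (the antidiagonal pairing) is a largest-first
-- assignment. If i is the u-th machine served in the largest-first order of σ,
-- the u+1 machines served no later carry rank-2 jobs at least as long as i's,
-- and the m−u machines served no earlier carry rank-1 jobs at least as long as
-- i's; by pigeonhole, some antidiagonal pair j dominates the rank-1 and rank-2
-- jobs of i. Pairing ranks 1 and 2 antidiagonally in P′ and moving the jobs of
-- ranks ≥ 3 of machine i to machine j gives an LD₀ schedule for P′ in which
-- machine j is at least as loaded as i is in σ, because no processing time
-- decreased.

open import Defs
open import Data.Nat using (ℕ; zero; suc)
import Data.Nat.Properties as ℕ
open import Data.Fin using (Fin; zero; suc; toℕ; opposite; punchOut)
  renaming (_≤_ to _≤ᶠ_; _<_ to _<ᶠ_)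
open import Data.Fin.Properties
  using (_≟_; any?; <⇒notInjective; punchOut-injective; injective⇒existsPivot;
         opposite-prop; opposite-involutive)
open import Data.Fin.Permutation.Components using (transpose; transpose-inverse)
open import Data.Rational using (ℚ) renaming (_≤_ to _≤ℚ_; _<_ to _<ℚ_)
open import Data.Rational.Properties
  using (≤-refl; ≤-trans; ≤-reflexive; +-mono-≤; p≤p⊔q; p≤q⊔p; ⊔-sel)
open import Data.Product using (Σ; ∃; ∃₂; _×_; _,_; proj₁; proj₂)
open import Data.Sum using (inj₁; inj₂)
open import Function using (_∘_; id)
open import Function.Definitions using (Injective; StrictlySurjective)
open import Relation.Nullary using (¬_)
open import Relation.Nullary.Decidable using (decidable-stable; dec-true)
open import Relation.Binary.PropositionalEquality
  using (_≡_; _≢_; refl; sym; trans; cong; subst)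

sumF-mono : ∀ n {f g : Fin n → ℚ} → (∀ i → f i ≤ℚ g i) → sumF n f ≤ℚ sumF n g
sumF-mono zero    f≤g = ≤-refl
sumF-mono (suc n) f≤g = +-mono-≤ (f≤g zero) (sumF-mono n (f≤g ∘ suc))

f≤maxF : ∀ n (f : Fin (suc n) → ℚ) i → f i ≤ℚ maxF n f
f≤maxF zero    f zero    = ≤-refl
f≤maxF (suc n) f zero    = p≤p⊔q _ _
f≤maxF (suc n) f (suc i) = ≤-trans (f≤maxF n (f ∘ suc) i) (p≤q⊔p (f zero) _)

maxF-attained : ∀ n (f : Fin (suc n) → ℚ) → ∃ λ i → maxF n f ≡ f i
maxF-attained zero    f = zero , refl
maxF-attained (suc n) f with ⊔-sel (f zero) (maxF n (f ∘ suc))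
... | inj₁ max≡f₀ = zero , max≡f₀
... | inj₂ max≡rest with i , rest≡fᵢ ← maxF-attained n (f ∘ suc) =
  suc i , trans max≡rest rest≡fᵢ

maxF-≤-at : ∀ n {f g : Fin (suc n) → ℚ} i j →
            maxF n f ≡ f i → f i ≤ℚ g j → maxF n f ≤ℚ maxF n g
maxF-≤-at n {g = g} i j max≡fᵢ fᵢ≤gⱼ = ≤-trans (≤-reflexive max≡fᵢ) (≤-trans fᵢ≤gⱼ (f≤maxF n g j))

injective⇒surjective : ∀ {n} {f : Fin n → Fin n} → Injective _≡_ _≡_ f → StrictlySurjective _≡_ f
injective⇒surjective {zero}      f-inj ()
injective⇒surjective {suc n} {f} f-inj y = decidable-stable (any? λ x → f x ≟ y) missed⇒⊥
  where
  missed⇒⊥ : ¬ ¬ ∃ λ x → f x ≡ y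
  missed⇒⊥ y∉img = <⇒notInjective (ℕ.n<1+n n) (f-inj ∘ punchOut-injective y≢f y≢f)
    where
    y≢f : ∀ {x} → y ≢ f x
    y≢f {x} y≡fx = y∉img (x , sym y≡fx)

-- The meeting point is the pivot of the injection f⁻¹ ∘ g at u.
injective-images-meet : ∀ {n} {f g : Fin n → Fin n} →
                        Injective _≡_ _≡_ f → Injective _≡_ _≡_ g →
                        ∀ u → ∃₂ λ v w → u ≤ᶠ v × w ≤ᶠ u × f v ≡ g w
injective-images-meet {n} {f} {g} f-inj g-inj u =
  meet (injective⇒existsPivot (g-inj ∘ f⁻¹-injective) u)
  where
  f⁻¹ : Fin n → Fin n
  f⁻¹ y = proj₁ (injective⇒surjective f-inj y)

  f∘f⁻¹ : ∀ y → f (f⁻¹ y) ≡ y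
  f∘f⁻¹ y = proj₂ (injective⇒surjective f-inj y)

  f⁻¹-injective : Injective _≡_ _≡_ f⁻¹
  f⁻¹-injective {x} {y} eq = trans (sym (f∘f⁻¹ x)) (trans (cong f eq) (f∘f⁻¹ y))

  meet : (∃ λ w → w ≤ᶠ u × u ≤ᶠ f⁻¹ (g w)) → ∃₂ λ v w → u ≤ᶠ v × w ≤ᶠ u × f v ≡ g w
  meet (w , w≤u , u≤v) = f⁻¹ (g w) , w , u≤v , w≤u , f∘f⁻¹ (g w)

opposite-injective : ∀ {n} → Injective _≡_ _≡_ (opposite {n})
opposite-injective {x = x} {y} eq =
  trans (sym (opposite-involutive x)) (trans (cong opposite eq) (opposite-involutive y))

opposite-antitone : ∀ {n} {i j : Fin (suc n)} → i ≤ᶠ j → opposite j ≤ᶠ opposite i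
opposite-antitone {n} {i} {j} i≤j
  rewrite opposite-prop i | opposite-prop j = ℕ.∸-monoʳ-≤ n i≤j

transpose-injective : ∀ {n} (i j : Fin n) → Injective _≡_ _≡_ (transpose i j)
transpose-injective i j {x} {y} eq =
  trans (sym (transpose-inverse j i)) (trans (cong (transpose j i) eq) (transpose-inverse j i))

transpose-left : ∀ {n} (i j : Fin n) → transpose i j i ≡ j
transpose-left i j rewrite dec-true (i ≟ i) refl = refl

largestFirst-dominated : ∀ {m'} {a b : Fin (suc m') → ℚ} {s t : Fin (suc m') → Fin (suc m')} →
                         Injective _≡_ _≡_ s → Injective _≡_ _≡_ t → LargestFirst a b s t →
                         ∀ i → ∃ λ j → a (s i) ≤ℚ a (opposite j) × b (t i) ≤ℚ b j
largestFirst-dominated {a = a} {b} {s} {t} s-inj t-inj (π , π-inj , b-antitone , a-least) i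
  with u , refl ← injective⇒surjective π-inj i
  with v , w , u≤v , w≤u , sπv≡tπw ←
         injective-images-meet {f = opposite ∘ s ∘ π} {g = t ∘ π}
                               (π-inj ∘ s-inj ∘ opposite-injective) (π-inj ∘ t-inj) u
  = t (π w) , a-bound , b-antitone w u w≤u
  where
  served-no-earlier : ∀ v′ → v′ <ᶠ u → π v′ ≢ π v
  served-no-earlier v′ v′<u πv′≡πv = ℕ.<⇒≱ v′<u (subst (u ≤ᶠ_) (sym (π-inj πv′≡πv)) u≤v)

  a-bound : a (s (π u)) ≤ℚ a (opposite (t (π w)))
  a-bound = ≤-trans (a-least u (π v) served-no-earlier) (≤-reflexive (cong a sπv≡opp-tπw))
    where
    sπv≡opp-tπw : s (π v) ≡ opposite (t (π w))
    sπv≡opp-tπw = trans (sym (opposite-involutive _)) (cong opposite sπv≡tπw)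

antidiagonal : ∀ {k m'} → Schedule (suc k) m' → Schedule (suc k) m'
antidiagonal ρ zero            = opposite
antidiagonal ρ (suc zero)      = id
antidiagonal ρ r@(suc (suc _)) = ρ r

antidiagonal-LD0 : ∀ {k m'} {p : Times (suc k) m'} {ρ : Schedule (suc k) m'} → FMInstance p →
                   (∀ r → Injective _≡_ _≡_ (ρ (suc (suc r)))) → LD0 p (antidiagonal ρ)
antidiagonal-LD0 {p = p} {ρ} I ρ-inj = record { bijective = bijective ; rank2 = rank2 }
  where
  open FMInstance I using (sorted-in)

  bijective : ∀ r → Injective _≡_ _≡_ (antidiagonal ρ r)
  bijective zero          = opposite-injective
  bijective (suc zero)    = id
  bijective (suc (suc r)) = ρ-inj r

  unserved⇒later : ∀ u i → (∀ v → v <ᶠ u → v ≢ i) → u ≤ᶠ i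
  unserved⇒later u i unserved = ℕ.≮⇒≥ λ i<u → unserved i i<u refl

  rank2 : ∀ r → toℕ r ≡ 1 → LargestFirst (p zero) (p r) opposite (antidiagonal ρ r)
  rank2 (suc zero) refl = id , id , sorted-in (suc zero) , λ u i unserved →
    sorted-in zero (opposite i) (opposite u) (opposite-antitone (unserved⇒later u i unserved))

pointwise-≤ : ∀ {k' m'} {p p' : Times k' m'} → (∀ i → p zero i ≤ℚ p' zero i) →
              (∀ r i → r ≢ zero → p' r i ≡ p r i) → ∀ r i → p r i ≤ℚ p' r i
pointwise-≤ p₀≤p₀' p'≡p zero    i = p₀≤p₀' i
pointwise-≤ p₀≤p₀' p'≡p (suc r) i = ≤-reflexive (sym (p'≡p (suc r) i λ ()))

proposition6p2 : (k' m' : ℕ) (p p' : Times k' m') →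
    FMInstance p → FMInstance p' →
    (∀ i → p zero i ≤ℚ p' zero i) →
    (∃ λ i → p zero i <ℚ p' zero i) →
    (∀ r i → r ≢ zero → p' r i ≡ p r i) →
    ∀ (σ : Schedule k' m') → LD0 p σ →
    Σ (Schedule k' m') λ σ' → LD0 p' σ' × makespan p σ ≤ℚ makespan p' σ'
proposition6p2 zero m' p p' _ _ p₀≤p₀' _ p'≡p σ σ-LD0
  with i , max≡ ← maxF-attained m' (load p σ)
  = σ , record { bijective = LD0.bijective σ-LD0 ; rank2 = λ { zero () } } ,
    maxF-≤-at m' i i max≡ (sumF-mono 1 λ r → pointwise-≤ p₀≤p₀' p'≡p r (σ r i))
proposition6p2 (suc k) m' p p' _ I' p₀≤p₀' _ p'≡p σ record { bijective = σ-inj ; rank2 = σ-rank2 }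
  with i , max≡ ← maxF-attained m' (load p σ)
  with j , rank1-dom , rank2-dom ←
         largestFirst-dominated {a = p zero} {b = p (suc zero)}
                                (σ-inj zero) (σ-inj (suc zero)) (σ-rank2 (suc zero) refl) i
  = σ′ , antidiagonal-LD0 I' (λ r → transpose-injective j i ∘ σ-inj (suc (suc r))) ,
    maxF-≤-at m' i j max≡ (sumF-mono (suc (suc k)) rank-wise)
  where
  σ′ : Schedule (suc k) m'
  σ′ = antidiagonal (λ r → σ r ∘ transpose j i)

  p≤p' : ∀ r x → p r x ≤ℚ p' r x
  p≤p' = pointwise-≤ p₀≤p₀' p'≡p

  rank-wise : ∀ r → p r (σ r i) ≤ℚ p' r (σ′ r j)
  rank-wise zero             = ≤-trans rank1-dom (p≤p' zero (opposite j))
  rank-wise (suc zero)       = ≤-trans rank2-dom (p≤p' (suc zero) j)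
  rank-wise r@(suc (suc _)) =
    ≤-trans (≤-reflexive (cong (p r ∘ σ r) (sym (transpose-left j i)))) (p≤p' r _)
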